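{- Let $\langle \mathbf{A}, \{N_x\}_{x\in A}\rangle$ be a complete saturated $C_\omega$-structure, and equip the class $\mathbf{V}^{\langle \mathbf{A},N\rangle}$ with the standard interpretation $\|\cdot\|$ (defined in the context). Then $\mathbf{V}^{\langle \mathbf{A},N\rangle}$ verifies Leibniz law: for every formula $\varphi(x)$ of $\mathcal{L}_{\langle \mathbf{A},N\rangle}$ with one free variable $x$ and all $u,v\in \mathbf{V}^{\langle \mathbf{A},N\rangle}$, $$\|(u\approx v\wedge \varphi(u))\to \varphi(v)\| = 1,$$ equivalently $\|u\approx v\|\wedge\|\varphi(u)\|\le \|\varphi(v)\|$.
   Context: A generalized Heyting algebra is $\mathbf{A}=\langle A,\vee,\wedge,\to,1\rangle$ where $\langle A,\vee,\wedge,1\rangle$ is a distributive lattice with greatest element $1$ and $a\to b$ is the greatest $z\in A$ with $a\wedge z\le b$. A $C_\omega$-structure is a pair $\langle \mathbf{A},\{N_x\}_{x\in A}\rangle$ with $\mathbf{A}$ a generalized Heyting algebra and $N_x\subseteq A$ such that (i) for every $x\in A$ there is $x'\in N_x$ with $x\vee x'=1$; (ii) for every $x'\in N_x$ there is $x''\in N_{x'}$ with $x''\le x$. It is complete if the lattice is complete (it then has a least element $0$ and $\mathbf{A}$ is a complete Heyting algebra). It is saturated if $N_x=\{y\in A: x\vee y=1\}$ for all $x\in A$ (so $1\in N_x$ for all $x$ and $N_1=A$). Fix a model $\mathbf{V}$ of set theory. By transfinite recursion let $\mathbf{V}_\xi^{\langle \mathbf{A},N\rangle}$ be the set of all functions $x$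 with $\mathrm{ran}(x)\subseteq A$ and $\mathrm{dom}(x)\subseteq \mathbf{V}_\zeta^{\langle \mathbf{A},N\rangle}$ for some $\zeta<\xi$, and $\mathbf{V}^{\langle \mathbf{A},N\rangle}=\bigcup_\xi \mathbf{V}_\xi^{\langle \mathbf{A},N\rangle}$. The language $\mathcal{L}_{\langle \mathbf{A},N\rangle}$ is the first-order language with connectives $\wedge,\vee,\to,\neg$, quantifiers $\exists,\forall$, binary predicates $\in$ and $\approx$, and a constant for each element of $\mathbf{V}^{\langle \mathbf{A},N\rangle}$. An interpretation $\|\cdot\|$ assigns to each closed formula an element of $A$ such that: $\|u\in v\|=\bigvee_{x\in\mathrm{dom}(v)}(v(x)\wedge\|x\approx u\|)$; $\|u\approx v\|=\bigwedge_{x\in\mathrm{dom}(u)}(u(x)\to\|x\in v\|)\wedge\bigwedge_{x\in\mathrm{dom}(v)}(v(x)\to\|x\in u\|)$ (these two by simultaneous well-founded recursion); $\|\varphi\#\psi\|=\|\varphi\|\#\|\psi\|$ for $\#\in\{\wedge,\vee,\to\}$; $\|\exists x\varphi\|=\bigvee_{u\in\mathbf{V}^{\langle \mathbf{A},N\rangle}}\|\varphi(u)\|$, $\|\forall x\varphi\|=\bigwedge_{u\in\mathbf{V}^{\langle \mathbf{A},N\rangle}}\|\varphi(u)\|$; and for negation $\|\neg\alpha\|\in N_{\|\alpha\|}$ and $\|\neg\neg\alpha\|\le\|\alpha\|$. The standard interpretation (on a complete saturated $C_\omega$-structure) is the interpretation in which, for every closed formula $\psi$ not of the form $\neg\phi$,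 $\|\neg\psi\|=1$ and $\|\neg\neg\psi\|=\|\psi\|$; consequently a formula consisting of an odd number of negations in front of such $\psi$ has value $1$, and one with an even number of negations in front of $\psi$ has value $\|\psi\|$. -}

module Defs where

open import Level using (Level; Lift; lift; lower) renaming (suc to lsuc; zero to lzero)
open import Data.Nat using (ℕ; zero; suc)
open import Data.Fin using (Fin; zero; suc)
open import Data.Product using (Σ; _×_; _,_)
open import Relation.Binary.PropositionalEquality using (_≡_)

-- Distributivity follows from residuation.
-- Joins/meets exist for every family indexed by a type in Set₁ (this is
-- needed because the universe V below lives in Set₁).

record CompleteHeytingAlgebra : Set₂ where
  infixr 6 _∧_
  infixr 5 _∨_
  infixr 4 _⇨_
  infix  3 _≤_
  field
    Carrier   : Set₁
    _≤_       : Carrier → Carrier → Set₁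
    ≤-refl    : ∀ {x} → x ≤ x
    ≤-trans   : ∀ {x y z} → x ≤ y → y ≤ z → x ≤ z
    ≤-antisym : ∀ {x y} → x ≤ y → y ≤ x → x ≡ y
    _∧_       : Carrier → Carrier → Carrier
    _∨_       : Carrier → Carrier → Carrier
    _⇨_       : Carrier → Carrier → Carrier
    ⊤         : Carrier
    ∧-lb₁     : ∀ {x y} → x ∧ y ≤ x
    ∧-lb₂     : ∀ {x y} → x ∧ y ≤ y
    ∧-glb     : ∀ {x y z} → z ≤ x → z ≤ y → z ≤ x ∧ y
    ∨-ub₁     : ∀ {x y} → x ≤ x ∨ y
    ∨-ub₂     : ∀ {x y} → y ≤ x ∨ y
    ∨-lub     : ∀ {x y z} → x ≤ z → y ≤ z → x ∨ y ≤ z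
    ⊤-max     : ∀ {x} → x ≤ ⊤
    ⇨-intro   : ∀ {a b z} → a ∧ z ≤ b → z ≤ a ⇨ b
    ⇨-elim    : ∀ {a b} → a ∧ (a ⇨ b) ≤ b
    ⋁         : {I : Set₁} → (I → Carrier) → Carrier
    ⋁-ub      : ∀ {I : Set₁} (f : I → Carrier) (i : I) → f i ≤ ⋁ f
    ⋁-lub     : ∀ {I : Set₁} (f : I → Carrier) {z} → (∀ i → f i ≤ z) → ⋁ f ≤ z
    ⋀         : {I : Set₁} → (I → Carrier) → Carrier
    ⋀-lb      : ∀ {I : Set₁} (f : I → Carrier) (i : I) → ⋀ f ≤ f i
    ⋀-glb     : ∀ {I : Set₁} (f : I → Carrier) {z} → (∀ i → z ≤ f i) → z ≤ ⋀ f

-- C_ω-structures: N x is the subset { y | N x y } of the carrier.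

module _ (H : CompleteHeytingAlgebra) where
  open CompleteHeytingAlgebra H

  record IsCω (N : Carrier → Carrier → Set₁) : Set₁ where
    field
      cond-i  : ∀ x → Σ Carrier λ x′ → N x x′ × (x ∨ x′ ≡ ⊤)
      cond-ii : ∀ x x′ → N x x′ → Σ Carrier λ x″ → N x′ x″ × (x″ ≤ x)

  IsSaturated : (N : Carrier → Carrier → Set₁) → Set₁
  IsSaturated N = ∀ x y → (N x y → x ∨ y ≡ ⊤) × (x ∨ y ≡ ⊤ → N x y)

-- The universe V^A : a name is a set-indexed family of (name, truth value)
-- pairs, i.e. a function from a set of earlier names into A.

module Universe (H : CompleteHeytingAlgebra) where
  open CompleteHeytingAlgebra H

  data V : Set₁ where
    sup : (I : Set) → (I → V) → (I → Carrier) → V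

  ⋁₀ : {I : Set} → (I → Carrier) → Carrier
  ⋁₀ {I} f = ⋁ {Lift (lsuc lzero) I} (λ i → f (lower i))

  ⋀₀ : {I : Set} → (I → Carrier) → Carrier
  ⋀₀ {I} f = ⋀ {Lift (lsuc lzero) I} (λ i → f (lower i))

  -- ‖ u ≈ v ‖, with ‖ x ∈ v ‖ unfolded (simultaneous recursion)
  ‖_≈_‖ : V → V → Carrier
  ‖ sup I f a ≈ sup J g b ‖ =
      ⋀₀ (λ i → a i ⇨ ⋁₀ (λ j → b j ∧ ‖ g j ≈ f i ‖))
    ∧ ⋀₀ (λ j → b j ⇨ ⋁₀ (λ i → a i ∧ ‖ f i ≈ g j ‖))

  ‖_∈_‖ : V → V → Carrier
  ‖ u ∈ sup J g b ‖ = ⋁₀ (λ j → b j ∧ ‖ g j ≈ u ‖)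

  -- The language L_⟨A,N⟩ : formulas with n free (de Bruijn) variables,
  -- and a constant for each element of V.

  data Term (n : ℕ) : Set₁ where
    var   : Fin n → Term n
    const : V → Term n

  infixr 6 _∧ᶠ_
  infixr 5 _∨ᶠ_
  infixr 4 _⇒ᶠ_
  infix  7 _∈ᶠ_ _≈ᶠ_

  data Formula (n : ℕ) : Set₁ where
    _∈ᶠ_ _≈ᶠ_       : Term n → Term n → Formula n
    _∧ᶠ_ _∨ᶠ_ _⇒ᶠ_  : Formula n → Formula n → Formula n
    ¬ᶠ_             : Formula n → Formula n
    ∃ᶠ ∀ᶠ           : Formula (suc n) → Formula n

  weakenT : ∀ {n} → Term n → Term (suc n)
  weakenT (var i)   = var (suc i)
  weakenT (const c) = const c

  liftσ : ∀ {m n} → (Fin m → Term n) → Fin (suc m) → Term (suc n)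
  liftσ σ zero    = var zero
  liftσ σ (suc i) = weakenT (σ i)

  substT : ∀ {m n} → (Fin m → Term n) → Term m → Term n
  substT σ (var i)   = σ i
  substT σ (const c) = const c

  subst : ∀ {m n} → (Fin m → Term n) → Formula m → Formula n
  subst σ (s ∈ᶠ t) = substT σ s ∈ᶠ substT σ t
  subst σ (s ≈ᶠ t) = substT σ s ≈ᶠ substT σ t
  subst σ (φ ∧ᶠ ψ) = subst σ φ ∧ᶠ subst σ ψ
  subst σ (φ ∨ᶠ ψ) = subst σ φ ∨ᶠ subst σ ψ
  subst σ (φ ⇒ᶠ ψ) = subst σ φ ⇒ᶠ subst σ ψ
  subst σ (¬ᶠ φ)   = ¬ᶠ subst σ φ
  subst σ (∃ᶠ φ)   = ∃ᶠ (subst (liftσ σ) φ)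
  subst σ (∀ᶠ φ)   = ∀ᶠ (subst (liftσ σ) φ)

  _[_] : Formula 1 → V → Formula 0
  φ [ u ] = subst (λ _ → const u) φ

  -- The standard interpretation, evaluated under an environment
  -- (for closed formulas, the environment is empty).
  -- ‖¬ψ‖ = 1 and ‖¬¬ψ‖ = ‖ψ‖ for ψ not a negation.

  Env : ℕ → Set₁
  Env n = Fin n → V

  _∷ₑ_ : ∀ {n} → V → Env n → Env (suc n)
  (u ∷ₑ ρ) zero    = u
  (u ∷ₑ ρ) (suc i) = ρ i

  evalT : ∀ {n} → Env n → Term n → V
  evalT ρ (var i)   = ρ i
  evalT ρ (const c) = c

  ⟦_⟧ : ∀ {n} → Formula n → Env n → Carrier
  ⟦ s ∈ᶠ t ⟧ ρ = ‖ evalT ρ s ∈ evalT ρ t ‖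
  ⟦ s ≈ᶠ t ⟧ ρ = ‖ evalT ρ s ≈ evalT ρ t ‖
  ⟦ φ ∧ᶠ ψ ⟧ ρ = ⟦ φ ⟧ ρ ∧ ⟦ ψ ⟧ ρ
  ⟦ φ ∨ᶠ ψ ⟧ ρ = ⟦ φ ⟧ ρ ∨ ⟦ ψ ⟧ ρ
  ⟦ φ ⇒ᶠ ψ ⟧ ρ = ⟦ φ ⟧ ρ ⇨ ⟦ ψ ⟧ ρ
  ⟦ ¬ᶠ (¬ᶠ ψ) ⟧ ρ = ⟦ ψ ⟧ ρ
  ⟦ ¬ᶠ ψ ⟧ ρ = ⊤
  ⟦ ∃ᶠ φ ⟧ ρ = ⋁ (λ (u : V) → ⟦ φ ⟧ (u ∷ₑ ρ))
  ⟦ ∀ᶠ φ ⟧ ρ = ⋀ (λ (u : V) → ⟦ φ ⟧ (u ∷ₑ ρ))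

  ‖_‖ : Formula 0 → Carrier
  ‖ φ ‖ = ⟦ φ ⟧ (λ ())

module _ (H : CompleteHeytingAlgebra) where
  open CompleteHeytingAlgebra H
  open Universe H

  VerifiesLeibniz : Set₁
  VerifiesLeibniz = (φ : Formula 1) (u v : V)
    → ‖ (const u ≈ᶠ const v ∧ᶠ φ [ u ]) ⇒ᶠ φ [ v ] ‖ ≡ ⊤

{-# OPTIONS --safe #-}
-- As for Boolean-valued models: ‖_≈_‖ is reflexive, symmetric and transitive
-- and ‖_∈_‖ respects it on both sides, transitivity and the two substitution
-- properties being proved simultaneously by induction on names. Writing
-- e = ‖ u ≈ v ‖, induction on φ then gives e ∧ ‖ φ(u) ‖ ≤ ‖ φ(v) ‖: connectives
-- and quantifiers are monotone (⇨ antitone on the left, where symmetry is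
-- used), and the standard interpretation makes ‖ ¬ψ ‖ either ⊤ or the value of
-- ψ with two negations removed.
module Submission where

open import Defs
open import Data.Fin using (Fin; zero; suc)
open import Level using (lift; lower)
open import Relation.Binary.PropositionalEquality using (_≡_; refl)

module Leibniz (H : CompleteHeytingAlgebra) where
  open CompleteHeytingAlgebra H
  open Universe H

  modus-ponens : ∀ {z a b} → z ≤ a → z ≤ a ⇨ b → z ≤ b
  modus-ponens p q = ≤-trans (∧-glb p q) ⇨-elim

  ⋁-elim : ∀ {I : Set₁} {f : I → Carrier} {z w} →
           z ≤ ⋁ f → (∀ i → z ∧ f i ≤ w) → z ≤ w
  ⋁-elim {f = f} p h = modus-ponens ≤-refl (≤-trans p (⋁-lub f (λ i → ⇨-intro (h i))))

  ∨-elim : ∀ {x y z w} → z ≤ x ∨ y → z ∧ x ≤ w → z ∧ y ≤ w → z ≤ w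
  ∨-elim p h k = modus-ponens ≤-refl (≤-trans p (∨-lub (⇨-intro h) (⇨-intro k)))

  ⋁₀-ub : ∀ {I : Set} (f : I → Carrier) (i : I) → f i ≤ ⋁₀ f
  ⋁₀-ub f i = ⋁-ub (λ j → f (lower j)) (lift i)

  ⋁₀-elim : ∀ {I : Set} {f : I → Carrier} {z w} →
            z ≤ ⋁₀ f → (∀ i → z ∧ f i ≤ w) → z ≤ w
  ⋁₀-elim p h = ⋁-elim p (λ i → h (lower i))

  ⋀₀-lb : ∀ {I : Set} (f : I → Carrier) (i : I) → ⋀₀ f ≤ f i
  ⋀₀-lb f i = ⋀-lb (λ j → f (lower j)) (lift i)

  ⋀₀-glb : ∀ {I : Set} (f : I → Carrier) {z} → (∀ i → z ≤ f i) → z ≤ ⋀₀ f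
  ⋀₀-glb f h = ⋀-glb (λ j → f (lower j)) (λ j → h (lower j))

  ∈-intro : ∀ {z} J g b (j : J) s → z ≤ b j → z ≤ ‖ g j ≈ s ‖ → z ≤ ‖ s ∈ sup J g b ‖
  ∈-intro J g b j s p q = ≤-trans (∧-glb p q) (⋁₀-ub (λ j → b j ∧ ‖ g j ≈ s ‖) j)

  ≈-intro : ∀ {z} I f a J g b →
            (∀ i → a i ∧ z ≤ ‖ f i ∈ sup J g b ‖) →
            (∀ j → b j ∧ z ≤ ‖ g j ∈ sup I f a ‖) →
            z ≤ ‖ sup I f a ≈ sup J g b ‖
  ≈-intro I f a J g b h k = ∧-glb (⋀₀-glb _ (λ i → ⇨-intro (h i))) (⋀₀-glb _ (λ j → ⇨-intro (k j)))

  ≈⇒∈ : ∀ {I f a z} {i : I} v → z ≤ ‖ sup I f a ≈ v ‖ → z ≤ a i → z ≤ ‖ f i ∈ v ‖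
  ≈⇒∈ {i = i} (sup J g b) p q = modus-ponens q (≤-trans p (≤-trans ∧-lb₁ (⋀₀-lb _ i)))

  ≈-refl : ∀ {z} u → z ≤ ‖ u ≈ u ‖
  ≈-refl (sup I f a) = ≈-intro I f a I f a f∈u f∈u
    where
    f∈u : ∀ {z} i → a i ∧ z ≤ ‖ f i ∈ sup I f a ‖
    f∈u i = ∈-intro I f a i (f i) ∧-lb₁ (≈-refl (f i))

  ≈-sym : ∀ {z} u v → z ≤ ‖ u ≈ v ‖ → z ≤ ‖ v ≈ u ‖
  ≈-sym (sup I f a) (sup J g b) p = ∧-glb (≤-trans p ∧-lb₂) (≤-trans p ∧-lb₁)

  ≈-trans : ∀ {z} u v w → z ≤ ‖ u ≈ v ‖ → z ≤ ‖ v ≈ w ‖ → z ≤ ‖ u ≈ w ‖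
  ∈-substˡ : ∀ {z} s s′ t → z ≤ ‖ s ≈ s′ ‖ → z ≤ ‖ s ∈ t ‖ → z ≤ ‖ s′ ∈ t ‖
  ∈-substʳ : ∀ {z} s t t′ → z ≤ ‖ t ≈ t′ ‖ → z ≤ ‖ s ∈ t ‖ → z ≤ ‖ s ∈ t′ ‖

  ≈-trans u@(sup I f a) v w@(sup K h c) p q = ≈-intro I f a K h c
    (λ i → ∈-substʳ (f i) v w (≤-trans ∧-lb₂ q) (≈⇒∈ v (≤-trans ∧-lb₂ p) ∧-lb₁))
    (λ k → ∈-substʳ (h k) v u (≈-sym u v (≤-trans ∧-lb₂ p))
                              (≈⇒∈ v (≈-sym v w (≤-trans ∧-lb₂ q)) ∧-lb₁))

  ∈-substˡ s s′ (sup K h c) p q = ⋁₀-elim q λ k →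
    ∈-intro K h c k s′ (≤-trans ∧-lb₂ ∧-lb₁) (≈-trans (h k) s s′ (≤-trans ∧-lb₂ ∧-lb₂) (≤-trans ∧-lb₁ p))

  ∈-substʳ s (sup J g b) t′ p q = ⋁₀-elim q λ j →
    ∈-substˡ (g j) s t′ (≤-trans ∧-lb₂ ∧-lb₂) (≈⇒∈ t′ (≤-trans ∧-lb₁ p) (≤-trans ∧-lb₂ ∧-lb₁))

  ∈-cong : ∀ {z} s s′ t t′ → z ≤ ‖ s ≈ s′ ‖ → z ≤ ‖ t ≈ t′ ‖ → z ≤ ‖ s ∈ t ‖ → z ≤ ‖ s′ ∈ t′ ‖
  ∈-cong s s′ t t′ p q r = ∈-substʳ s′ t t′ q (∈-substˡ s s′ t p r)

  ≈-cong : ∀ {z} s s′ t t′ → z ≤ ‖ s ≈ s′ ‖ → z ≤ ‖ t ≈ t′ ‖ → z ≤ ‖ s ≈ t ‖ → z ≤ ‖ s′ ≈ t′ ‖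
  ≈-cong s s′ t t′ p q r = ≈-trans s′ t t′ (≈-trans s′ s t (≈-sym s s′ p) r) q

  -- A record rather than a function type, so that ρ, σ₁ and σ₂ can be inferred.
  record Agree (z : Carrier) {m n} (ρ : Env n) (σ₁ σ₂ : Fin m → Term n) : Set₁ where
    field agree : ∀ i → z ≤ ‖ evalT ρ (σ₁ i) ≈ evalT ρ (σ₂ i) ‖
  open Agree

  Agree-mono : ∀ {w z m n} {ρ : Env n} {σ₁ σ₂ : Fin m → Term n} →
               w ≤ z → Agree z ρ σ₁ σ₂ → Agree w ρ σ₁ σ₂
  agree (Agree-mono w≤z R) i = ≤-trans w≤z (agree R i)

  Agree-sym : ∀ {z m n} {ρ : Env n} {σ₁ σ₂ : Fin m → Term n} →
              Agree z ρ σ₁ σ₂ → Agree z ρ σ₂ σ₁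
  agree (Agree-sym {ρ = ρ} {σ₁} {σ₂} R) i = ≈-sym (evalT ρ (σ₁ i)) (evalT ρ (σ₂ i)) (agree R i)

  evalT-weakenT : ∀ {n} (u : V) (ρ : Env n) t → evalT (u ∷ₑ ρ) (weakenT t) ≡ evalT ρ t
  evalT-weakenT u ρ (var i)   = refl
  evalT-weakenT u ρ (const c) = refl

  Agree-lift : ∀ {z m n} {ρ : Env n} {σ₁ σ₂ : Fin m → Term n} (u : V) →
               Agree z ρ σ₁ σ₂ → Agree z (u ∷ₑ ρ) (liftσ σ₁) (liftσ σ₂)
  agree (Agree-lift u R) zero = ≈-refl u
  agree (Agree-lift {ρ = ρ} {σ₁} {σ₂} u R) (suc i)
    rewrite evalT-weakenT u ρ (σ₁ i) | evalT-weakenT u ρ (σ₂ i) = agree R i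

  substT-cong : ∀ {z m n} {ρ : Env n} {σ₁ σ₂ : Fin m → Term n} → Agree z ρ σ₁ σ₂ →
                ∀ t → z ≤ ‖ evalT ρ (substT σ₁ t) ≈ evalT ρ (substT σ₂ t) ‖
  substT-cong R (var i)   = agree R i
  substT-cong R (const c) = ≈-refl c

  subst-leibniz : ∀ {z m n} {ρ : Env n} {σ₁ σ₂ : Fin m → Term n} → Agree z ρ σ₁ σ₂ →
                  ∀ φ → z ≤ ⟦ subst σ₁ φ ⟧ ρ → z ≤ ⟦ subst σ₂ φ ⟧ ρ
  subst-leibniz {ρ = ρ} {σ₁} {σ₂} R (s ∈ᶠ t) =
    ∈-cong (evalT ρ (substT σ₁ s)) (evalT ρ (substT σ₂ s))
           (evalT ρ (substT σ₁ t)) (evalT ρ (substT σ₂ t))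
           (substT-cong R s) (substT-cong R t)
  subst-leibniz {ρ = ρ} {σ₁} {σ₂} R (s ≈ᶠ t) =
    ≈-cong (evalT ρ (substT σ₁ s)) (evalT ρ (substT σ₂ s))
           (evalT ρ (substT σ₁ t)) (evalT ρ (substT σ₂ t))
           (substT-cong R s) (substT-cong R t)
  subst-leibniz R (φ ∧ᶠ ψ) p =
    ∧-glb (subst-leibniz R φ (≤-trans p ∧-lb₁)) (subst-leibniz R ψ (≤-trans p ∧-lb₂))
  subst-leibniz R (φ ∨ᶠ ψ) p = ∨-elim p
    (≤-trans (subst-leibniz (Agree-mono ∧-lb₁ R) φ ∧-lb₂) ∨-ub₁)
    (≤-trans (subst-leibniz (Agree-mono ∧-lb₁ R) ψ ∧-lb₂) ∨-ub₂)
  subst-leibniz R (φ ⇒ᶠ ψ) p = ⇨-intro (subst-leibniz (Agree-mono ∧-lb₂ R) ψ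
    (modus-ponens (subst-leibniz (Agree-sym (Agree-mono ∧-lb₂ R)) φ ∧-lb₁) (≤-trans ∧-lb₂ p)))
  -- ⟦ ¬ᶠ ψ ⟧ only computes once the head constructor of ψ is known.
  subst-leibniz R (¬ᶠ (¬ᶠ ψ))   = subst-leibniz R ψ
  subst-leibniz R (¬ᶠ (_ ∈ᶠ _)) _ = ⊤-max
  subst-leibniz R (¬ᶠ (_ ≈ᶠ _)) _ = ⊤-max
  subst-leibniz R (¬ᶠ (_ ∧ᶠ _)) _ = ⊤-max
  subst-leibniz R (¬ᶠ (_ ∨ᶠ _)) _ = ⊤-max
  subst-leibniz R (¬ᶠ (_ ⇒ᶠ _)) _ = ⊤-max
  subst-leibniz R (¬ᶠ (∃ᶠ _))   _ = ⊤-max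
  subst-leibniz R (¬ᶠ (∀ᶠ _))   _ = ⊤-max
  subst-leibniz R (∃ᶠ φ) p = ⋁-elim p λ u →
    ≤-trans (subst-leibniz (Agree-lift u (Agree-mono ∧-lb₁ R)) φ ∧-lb₂) (⋁-ub _ u)
  subst-leibniz R (∀ᶠ φ) p = ⋀-glb _ λ u →
    subst-leibniz (Agree-lift u R) φ (≤-trans p (⋀-lb _ u))

theorem4p1 : (H : CompleteHeytingAlgebra)
    (N : CompleteHeytingAlgebra.Carrier H → CompleteHeytingAlgebra.Carrier H → Set₁)
    → IsCω H N → IsSaturated H N
    → VerifiesLeibniz H
theorem4p1 H _ _ _ φ u v = ≤-antisym ⊤-max (⇨-intro (subst-leibniz u≈v φ (≤-trans ∧-lb₁ ∧-lb₂)))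
  where
  open CompleteHeytingAlgebra H
  open Universe H
  open Leibniz H

  u≈v : Agree ((‖ u ≈ v ‖ ∧ ⟦ φ [ u ] ⟧ _) ∧ ⊤) (λ ()) (λ _ → const u) (λ _ → const v)
  Agree.agree u≈v _ = ≤-trans ∧-lb₁ ∧-lb₁
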